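{- In the internal logic of $\mathcal{S}$: $\forall\,\kappa:\mathbb{K}.\ \forall\,\phi:\Omega.\ \phi\Rightarrow\triangleright^{\kappa}\phi$.
   Context: Let $\mathbb{F}^+$ be the category whose objects are $\bullet^n$ for $n>0$ (free category with strictly associative binary products on one object); a morphism $\bullet^n\to\bullet^m$ is equivalently a function $\{0,\dots,m-1\}\to\{0,\dots,n-1\}$. Let $\mathcal{N}=\mathrm{Hom}_{\mathbb{F}^+}(-,\bullet^1)$. For $U\in\mathbb{F}^+$ let $\mathrm{CLK}[U]=\omega^{\mathcal{N}(U)}$ ordered pointwise, with $\mathrm{CLK}[f](\partial_V)=(\kappa\mapsto\partial_V(f^*\kappa))$ for $f:V\to U$. The category $\mathbb{CLK}$ has objects $\mathbf{U}=(U,\partial_U)$ and morphisms $f:(V,\partial_V)\to(U,\partial_U)$ the $\mathbb{F}^+$-maps $f:V\to U$ with $\mathrm{CLK}[f](\partial_V)\le\partial_U$. $\mathcal{S}$ is the presheaf topos on $\mathbb{CLK}$, with clock object $\mathbb{K}(U,\partial_U)=\mathcal{N}(U)$ and subobject classifier $\Omega$. Write $\mathbf{U}[\kappa\mapsto n]$ for $(U,\partial_U[\kappa\mapsto n])$ and $[\kappa\mathrel{+}=1]:\mathbf{U}\to\mathbf{U}[\kappa\mapsto\partial_U(\kappa)+1]$ for the morphism with identity underlying map. The later modality is defined by forcing: $\mathbf{U}\Vdash\triangleright^{\kappa}\phi(\alpha)$ iff $\partial_U(\kappa)=0$, or $\partial_U(\kappa)=n+1$ and $\mathbf{U}[\kappa\mapsto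 n]\Vdash\phi([\kappa\mathrel{+}=1]^*\alpha)$. Other connectives are interpreted by standard Kripke–Joyal semantics. -}

module Defs where

open import Level using (Level; Lift; lift; lower) renaming (suc to lsuc; zero to lzero)
open import Data.Nat using (ℕ; zero; suc; _≤_)
open import Data.Nat.Properties using (≤-refl; ≤-trans; n≤1+n)
open import Data.Fin using (Fin; _≟_)
open import Data.Product using (Σ; _×_; _,_)
open import Data.Sum using (_⊎_)
open import Data.Unit using (⊤; tt)
open import Relation.Nullary using (yes; no)
open import Relation.Binary.PropositionalEquality using (_≡_; refl)

-- An object •^(suc s) of F⁺ (arity > 0) together with a clock assignment.
-- N(•^n) = Hom(•^n, •^1) = functions Fin 1 → Fin n, identified with Fin n.
-- CLK[U] = ω^{N(U)}, so ∂ : Fin n → ℕ.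

record Obj : Set where
  constructor obj
  field
    size : ℕ                     -- the object is •^(suc size)
    ∂    : Fin (suc size) → ℕ
open Obj public

Clk : Obj → Set
Clk U = Fin (suc (size U))

-- A morphism f : V → U is an F⁺-map, i.e. a function Clk U → Clk V
-- (so that f*κ = fun f κ), with CLK[f](∂_V) ≤ ∂_U pointwise.
-- The inequality proof is irrelevant (it is a proposition).
record Hom (V U : Obj) : Set where
  constructor hom
  field
    fun : Clk U → Clk V
    .le : ∀ κ → ∂ V (fun κ) ≤ ∂ U κ
open Hom public

idH : ∀ {U} → Hom U U
idH = hom (λ κ → κ) (λ κ → ≤-refl)

_∘H_ : ∀ {U V W} → Hom V U → Hom W V → Hom W U
hom f lf ∘H hom g lg = hom (λ κ → g (f κ)) (λ κ → ≤-trans (lg (f κ)) (lf κ))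

upd : ∀ {s} → (Fin (suc s) → ℕ) → Fin (suc s) → ℕ → Fin (suc s) → ℕ
upd d κ n κ' with κ' ≟ κ
... | yes _ = n
... | no  _ = d κ'

_[_↦_] : (U : Obj) → Clk U → ℕ → Obj
U [ κ ↦ n ] = obj (size U) (upd (∂ U) κ n)

-- [κ += 1] : U[κ ↦ n] → U[κ ↦ n+1], where ∂_U(κ) = n+1 (so the codomain is U).
incr-le : (U : Obj) (κ : Clk U) (n : ℕ) → ∂ U κ ≡ suc n →
          ∀ κ' → upd (∂ U) κ n κ' ≤ ∂ U κ'
incr-le U κ n e κ' with κ' ≟ κ
incr-le U κ n e κ' | yes refl rewrite e = n≤1+n n
incr-le U κ n e κ' | no _ = ≤-refl

incr : (U : Obj) (κ : Clk U) (n : ℕ) → ∂ U κ ≡ suc n → Hom (U [ κ ↦ n ]) U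
incr U κ n e = hom (λ κ' → κ') (incr-le U κ n e)

-- Presheaves on CLK (only the data needed for Kripke–Joyal forcing).

record Presheaf : Set₂ where
  field
    F₀  : Obj → Set₁
    res : ∀ {U V} → F₀ U → Hom V U → F₀ V
open Presheaf public

𝟙 : Presheaf
𝟙 = record { F₀ = λ _ → Lift (lsuc lzero) ⊤ ; res = λ x _ → x }

_⊗_ : Presheaf → Presheaf → Presheaf
A ⊗ B = record
  { F₀ = λ U → F₀ A U × F₀ B U
  ; res = λ { (a , b) f → res A a f , res B b f } }

𝕂 : Presheaf
𝕂 = record { F₀ = λ U → Lift (lsuc lzero) (Clk U) ; res = λ k f → lift (fun f (lower k)) }

record Sieve (U : Obj) : Set₁ where
  field
    mem    : ∀ {V} → Hom V U → Set
    closed : ∀ {V W} (f : Hom V U) (g : Hom W V) → mem f → mem (f ∘H g)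
open Sieve public

pullback : ∀ {U V} → Sieve U → Hom V U → Sieve V
pullback α f = record
  { mem = λ g → mem α (f ∘H g)
  ; closed = λ g h p → closed α (f ∘H g) h p }

Ω : Presheaf
Ω = record { F₀ = Sieve ; res = pullback }

-- Kripke–Joyal forcing (shallow embedding).

Formula : Presheaf → Set₂
Formula Γ = (U : Obj) → F₀ Γ U → Set₁

Term : Presheaf → Presheaf → Set₁
Term Γ A = (U : Obj) → F₀ Γ U → F₀ A U

Atom : ∀ {Γ} → Term Γ Ω → Formula Γ
Atom α U γ = Lift (lsuc lzero) (mem (α U γ) idH)

_⇒_ : ∀ {Γ} → Formula Γ → Formula Γ → Formula Γ
(_⇒_ {Γ} φ ψ) U γ = ∀ {V} (f : Hom V U) → φ V (res Γ γ f) → ψ V (res Γ γ f)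

Forall : ∀ {Γ} (A : Presheaf) → Formula (Γ ⊗ A) → Formula Γ
Forall {Γ} A φ U γ = ∀ {V} (f : Hom V U) (a : F₀ A V) → φ V (res Γ γ f , a)

Later : ∀ {Γ} → ((U : Obj) → F₀ Γ U → Clk U) → Formula Γ → Formula Γ
Later {Γ} κ φ U γ =
  Lift (lsuc lzero) (∂ U (κ U γ) ≡ 0)
  ⊎ Σ ℕ (λ n → Σ (∂ U (κ U γ) ≡ suc n) (λ e →
        φ (U [ κ U γ ↦ n ]) (res Γ γ (incr U (κ U γ) n e))))

-- validity in S: forced at every stage (equivalently at the terminal object)
Valid : Formula 𝟙 → Set₁
Valid φ = ∀ (U : Obj) → φ U (lift tt)

varκ : (U : Obj) → F₀ ((𝟙 ⊗ 𝕂) ⊗ Ω) U → Clk U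
varκ U ((_ , k) , _) = lower k

varφ : Term ((𝟙 ⊗ 𝕂) ⊗ Ω) Ω
varφ U (_ , a) = a

Ctx : Presheaf
Ctx = (𝟙 ⊗ 𝕂) ⊗ Ω

module Submission where

-- The formula  φ ⇒ ▷^κ φ  is an instance of a general fact of
-- Kripke–Joyal semantics: whenever a formula φ is *monotone* (forced at a
-- stage U, it stays forced along every restriction V → U), then φ implies
-- ▷^κ φ at every stage, for every clock κ.  Indeed, at a stage U either
-- ∂_U(κ) = 0, and ▷^κ φ holds trivially, or ∂_U(κ) = n+1, and then
-- U[κ ↦ n] ⊩ φ follows from U ⊩ φ by monotonicity along [κ += 1].
--
-- It then shows that
-- atomic formulas  id ∈ α  on the Ω-variable are monotone, because a sieve
-- containing the identity contains every arrow (sieves are closed under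
-- precomposition).

open import Defs
open import Level using (lift)
open import Data.Nat using (zero; suc)
open import Data.Sum using (inj₁; inj₂)
open import Data.Product using (_,_)
open import Relation.Binary.PropositionalEquality using (_≡_; refl)

Monotone : (Γ : Presheaf) → Formula Γ → Set₁
Monotone Γ φ = ∀ {U V} (γ : F₀ Γ U) (f : Hom V U) → φ U γ → φ V (res Γ γ f)

-- The clock is either exhausted (▷ holds vacuously) or has a predecessor n,
-- and then φ is transported to U[κ ↦ n] along [κ += 1].
later-intro : ∀ Γ (κ : (U : Obj) → F₀ Γ U → Clk U) (φ : Formula Γ) →
              Monotone Γ φ → ∀ U (γ : F₀ Γ U) → φ U γ → Later {Γ} κ φ U γ
later-intro Γ κ φ mono U γ φ-holds = by-clock-value (∂ U (κ U γ)) refl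
  where
  by-clock-value : ∀ m → ∂ U (κ U γ) ≡ m → Later {Γ} κ φ U γ
  by-clock-value zero    clock = inj₁ (lift clock)
  by-clock-value (suc n) clock =
    inj₂ (n , clock , mono γ (incr U (κ U γ) n clock) φ-holds)

later-intro-⇒ : ∀ Γ (κ : (U : Obj) → F₀ Γ U → Clk U) (φ : Formula Γ) →
                Monotone Γ φ → ∀ U (γ : F₀ Γ U) → (_⇒_ {Γ} φ (Later {Γ} κ φ)) U γ
later-intro-⇒ Γ κ φ mono U γ f = later-intro Γ κ φ mono _ (res Γ γ f)

-- A sieve containing the identity still contains it after pullback along
-- any arrow: f*α ∋ id  amounts to  α ∋ f = id ∘ f, by closure of α.
identity-in-pullback : ∀ {U V} (α : Sieve U) (f : Hom V U) →
                       mem α idH → mem (pullback α f) idH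
identity-in-pullback α f id∈α = closed α idH f id∈α

atom-monotone : Monotone Ctx (Atom {Ctx} varφ)
atom-monotone (_ , α) f (lift id∈α) = lift (identity-in-pullback α f id∈α)

mainTheorem4 : Valid (Forall {𝟙} 𝕂 (Forall {𝟙 ⊗ 𝕂} Ω
    (_⇒_ {Ctx} (Atom {Ctx} varφ) (Later {Ctx} varκ (Atom {Ctx} varφ)))))
mainTheorem4 U f k g α =
  later-intro-⇒ Ctx varκ (Atom {Ctx} varφ) atom-monotone _ ((_ , res 𝕂 k g) , α)
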